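{- For $n\geq 3$, let $f(\overleftrightarrow{K}_{n})$ denote the smallest integer such that every arc-colored complete digraph $\overleftrightarrow{K}_{n}$ on $n$ vertices with $c(\overleftrightarrow{K}_{n})\geq f(\overleftrightarrow{K}_{n})$ contains a rainbow triangle. Then \[f(\overleftrightarrow{K}_{n})=\begin{cases} \lfloor\frac{n^{2}}{4}\rfloor+3,&\text{if } n=3, 4;\\ \lfloor\frac{n^{2}}{4}\rfloor+2,&\text{if } n\geq 5. \end{cases}\]
   Context: Digraphs are finite, without loops or multiple arcs. The complete digraph $\overleftrightarrow{K}_{n}$ is obtained from the complete graph $K_n$ by replacing each edge $xy$ with the two arcs $xy$ and $yx$. An arc-coloring of a digraph $D$ is a map $C:A(D)\to\mathbb{N}$; $C(D)$ is the set of colors used on the arcs of $D$ and $c(D)=|C(D)|$ is its color number. A rainbow triangle is a directed cycle of length $3$ whose three arcs have pairwise distinct colors. -}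

module Defs where

open import Data.Nat using (ℕ; _≤_; _/_; _*_)
import Data.Nat as ℕ
open import Data.Fin using (Fin)
import Data.Fin as Fin
open import Data.List using (List; length; map; filter; cartesianProduct; deduplicate)
open import Data.List.Base using (allFin)
open import Data.Product using (_×_; _,_; ∃-syntax; proj₁; proj₂)
open import Relation.Nullary using (¬_; ¬?)
open import Relation.Binary.PropositionalEquality using (_≡_; _≢_)

arcs : (n : ℕ) → List (Fin n × Fin n)
arcs n = filter (λ p → ¬? (proj₁ p Fin.≟ proj₂ p)) (cartesianProduct (allFin n) (allFin n))

-- An arc-coloring of the complete digraph on n vertices: C x y is the color of
-- the arc xy.  Values on the diagonal (x ≡ y, not an arc) are ignored.
ArcColoring : ℕ → Set
ArcColoring n = Fin n → Fin n → ℕ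

colorNumber : {n : ℕ} → ArcColoring n → ℕ
colorNumber {n} C = length (deduplicate ℕ._≟_ (map (λ p → C (proj₁ p) (proj₂ p)) (arcs n)))

HasRainbowTriangle : {n : ℕ} → ArcColoring n → Set
HasRainbowTriangle {n} C =
  ∃[ x ] ∃[ y ] ∃[ z ]
    (x ≢ y × y ≢ z × x ≢ z ×
     C x y ≢ C y z × C y z ≢ C z x × C x y ≢ C z x)

Forces : ℕ → ℕ → Set
Forces n k = (C : ArcColoring n) → k ≤ colorNumber C → HasRainbowTriangle C

IsLeast : (ℕ → Set) → ℕ → Set
IsLeast P v = P v × ((m : ℕ) → P m → v ≤ m)

fValue : ℕ → ℕ
fValue 3 = (3 * 3) / 4 ℕ.+ 3
fValue 4 = (4 * 4) / 4 ℕ.+ 3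
fValue n = (n * n) / 4 ℕ.+ 2

module Submission where

-- Upper bound.  Call a color private at v if it occurs only on arcs at v; then c(C) is at most
-- c(C − v) plus the number p(v) of private colors at v.  In a rainbow-free coloring a vertex
-- with both a private out- and a private in-color has p(v) ≤ 2, and a vertex all of whose private
-- colors are out-colors (in-colors) can only send them to (receive them from) vertices of the other
-- kind once p ≥ 3 everywhere; counting the two kinds gives a vertex with p(v) ≤ ⌊n/2⌋.  Since
-- ⌊n²/4⌋ + ⌈n/2⌉ = ⌊(n+1)²/4⌋, induction from c ≤ 4 on three vertices gives c ≤ 6 on four and,
-- starting from c ≤ 7 on five vertices, c ≤ ⌊n²/4⌋ + 1 from then on.  The case of five vertices
-- reduces, by the same inequality, to a K₄ carrying six colors, which is settled by an exhaustive
-- search over color patterns.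
-- Lower bound.  Explicit rainbow-free colorings with 4 and 6 colors on three and four vertices and,
-- for n ≥ 5, arcs from ⌊n/2⌋ vertices to the other ⌈n/2⌉ colored injectively, all other arcs
-- sharing one further color.

open import Defs
open import Data.Bool using (Bool; true; false; T; _∧_; _∨_; if_then_else_)
open import Data.Bool.Properties using (T-≡; T-∧; T-∨)
open import Data.Empty using (⊥; ⊥-elim)
open import Data.Fin using (Fin; zero; suc; toℕ; fromℕ<; punchIn; splitAt; combine; _↑ˡ_; _↑ʳ_)
import Data.Fin as Fin
open import Data.Fin.Patterns using (0F; 1F; 2F; 3F; 4F)
open import Data.Fin.Permutation using (Permutation; _⟨$⟩ʳ_; _⟨$⟩ˡ_; inverseˡ; inverseʳ; insert; insert-punchIn)
import Data.Fin.Permutation as Permutation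
open import Data.Fin.Properties
  using (any?; all?; punchIn-injective; punchIn-punchOut; splitAt-↑ˡ; splitAt-↑ʳ; combine-surjective; toℕ-fromℕ<)
open import Data.List
  using (List; []; _∷_; _++_; _∷ʳ_; length; map; filter; upTo; applyUpTo; deduplicate; cartesianProduct; allFin)
open import Data.List.Properties using (length-++; length-map; length-tabulate; length-applyUpTo; filter-notAll; map-cong)
open import Data.List.Membership.Propositional using (_∈_; _∉_)
open import Data.List.Membership.Propositional.Properties
  using (∈-filter⁺; ∈-filter⁻; ∈-upTo⁺; ∈-upTo⁻; ∈-applyUpTo⁺; ∈-++⁻; ∈-++⁺ˡ; ∈-++⁺ʳ; ∈-deduplicate⁺; ∈-deduplicate⁻;
         ∈-map⁺; ∈-map⁻; ∈-cartesianProduct⁺; ∈-allFin)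
open import Data.List.Relation.Binary.Subset.Propositional using (_⊆_)
open import Data.List.Relation.Unary.Any using (here; there)
import Data.List.Relation.Unary.Any as Any
open import Data.List.Relation.Unary.All using (All; []; _∷_)
import Data.List.Relation.Unary.All as All
open import Data.List.Relation.Unary.Unique.Propositional using (Unique; []; _∷_)
open import Data.List.Relation.Unary.Unique.Propositional.Properties using (upTo⁺)
import Data.List.Relation.Unary.Unique.Propositional.Properties as Unique
open import Data.List.Relation.Unary.Unique.DecPropositional.Properties using (deduplicate-!)
open import Data.Nat
  using (ℕ; zero; suc; _+_; _*_; _∸_; _/_; _≤_; _<_; _≤?_; _<?_; z≤n; s≤s; s≤s⁻¹; s<s⁻¹; _≟_; _<ᵇ_; _≡ᵇ_; ⌊_/2⌋; ⌈_/2⌉)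
open import Data.List.Membership.DecPropositional _≟_ using (_∈?_; _∉?_)
open import Data.Nat.DivMod using (+-distrib-/-∣ʳ; m*n/n≡m)
open import Data.Nat.Divisibility using (divides-refl)
open import Data.Nat.Properties
  using (≤-refl; ≤-trans; ≤-reflexive; ≤-pred; <-≤-trans; ≤⇒≯; ≰⇒>; <⇒≱; ≮⇒≥; n≤1+n; n<1+n; m<n⇒m<1+n; m<m+n;
         m≤n⇒m<n∨m≡n; +-suc; +-comm; +-assoc; +-mono-≤; +-monoʳ-≤; m+[n∸m]≡n; m+n∸m≡n; ∸-monoˡ-<;
         <ᵇ⇒<; ≡ᵇ⇒≡; ≡⇒≡ᵇ; allUpTo?; anyUpTo?; ⌊n/2⌋-mono; ⌊n/2⌋+⌈n/2⌉≡n)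
open import Data.Nat.Tactic.RingSolver using (solve-∀)
open import Data.Product using (_×_; _,_; proj₁; proj₂; ∃; ∃-syntax)
open import Data.Product.Properties using (≡-dec)
open import Data.Sum using (_⊎_; inj₁; inj₂)
import Data.Sum as Sum
open import Function using (_∘_; id)
open import Function.Bundles using (Equivalence)
open import Function.Definitions using (Injective)
open import Relation.Binary.Definitions using (DecidableEquality)
open import Relation.Binary.PropositionalEquality
  using (_≡_; _≢_; refl; sym; trans; cong; cong₂; subst; subst₂; module ≡-Reasoning)
open import Relation.Nullary using (¬_; ¬?; yes; no; Dec; _×-dec_; _→-dec_; contradiction)
open import Relation.Nullary.Decidable using (decidable-stable; toWitness; toWitnessFalse)
open import Relation.Unary using (Pred; Decidable)

module _ {a} {A : Set a} (_≟ᴬ_ : DecidableEquality A) where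

  Unique-⊆⇒length≤ : ∀ {xs ys : List A} → Unique xs → xs ⊆ ys → length xs ≤ length ys
  Unique-⊆⇒length≤ {[]} _ _ = z≤n
  Unique-⊆⇒length≤ {x ∷ xs} {ys} (x∉xs ∷ xs!) xs⊆ys =
    ≤-trans (s≤s (Unique-⊆⇒length≤ xs! xs⊆ys-x))
            (filter-notAll (¬? ∘ (_≟ᴬ x)) ys (Any.map (λ x≡z z≢x → z≢x (sym x≡z)) (xs⊆ys (here refl))))
    where
    xs⊆ys-x : xs ⊆ filter (¬? ∘ (_≟ᴬ x)) ys
    xs⊆ys-x z∈xs = ∈-filter⁺ (¬? ∘ (_≟ᴬ x)) (xs⊆ys (there z∈xs)) (All.lookup x∉xs z∈xs ∘ sym)

countDistinct : List ℕ → ℕ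
countDistinct xs = length (deduplicate _≟_ xs)

Unique-⊆⇒length≤countDistinct : ∀ {xs ys} → Unique xs → xs ⊆ ys → length xs ≤ countDistinct ys
Unique-⊆⇒length≤countDistinct xs! xs⊆ys = Unique-⊆⇒length≤ _≟_ xs! (∈-deduplicate⁺ _≟_ ∘ xs⊆ys)

countDistinct-mono : ∀ {xs ys} → xs ⊆ ys → countDistinct xs ≤ countDistinct ys
countDistinct-mono {xs} xs⊆ys =
  Unique-⊆⇒length≤countDistinct (deduplicate-! _≟_ xs) (xs⊆ys ∘ ∈-deduplicate⁻ _≟_ xs)

⊆⇒countDistinct≤length : ∀ {xs ys} → xs ⊆ ys → countDistinct xs ≤ length ys
⊆⇒countDistinct≤length {xs} xs⊆ys =
  Unique-⊆⇒length≤ _≟_ (deduplicate-! _≟_ xs) (xs⊆ys ∘ ∈-deduplicate⁻ _≟_ xs)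

countDistinct-++ : ∀ xs ys → countDistinct (xs ++ ys) ≤ countDistinct xs + countDistinct ys
countDistinct-++ xs ys = ≤-trans (⊆⇒countDistinct≤length split) (≤-reflexive (length-++ (deduplicate _≟_ xs)))
  where
  split : xs ++ ys ⊆ deduplicate _≟_ xs ++ deduplicate _≟_ ys
  split z∈ with ∈-++⁻ xs z∈
  ... | inj₁ z∈xs = ∈-++⁺ˡ (∈-deduplicate⁺ _≟_ z∈xs)
  ... | inj₂ z∈ys = ∈-++⁺ʳ (deduplicate _≟_ xs) (∈-deduplicate⁺ _≟_ z∈ys)

RainbowFree : ∀ {n} → ArcColoring n → Set
RainbowFree C = ¬ HasRainbowTriangle C

hasRainbowTriangle? : ∀ {n} (C : ArcColoring n) → Dec (HasRainbowTriangle C)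
hasRainbowTriangle? C = any? λ x → any? λ y → any? λ z →
  ¬? (x Fin.≟ y) ×-dec ¬? (y Fin.≟ z) ×-dec ¬? (x Fin.≟ z) ×-dec
  ¬? (C x y ≟ C y z) ×-dec ¬? (C y z ≟ C z x) ×-dec ¬? (C x y ≟ C z x)

colors : ∀ {n} → ArcColoring n → List ℕ
colors {n} C = map (λ p → C (proj₁ p) (proj₂ p)) (arcs n)

∈-arcs⁺ : ∀ {n} {x y : Fin n} → x ≢ y → (x , y) ∈ arcs n
∈-arcs⁺ x≢y =
  ∈-filter⁺ (λ p → ¬? (proj₁ p Fin.≟ proj₂ p)) (∈-cartesianProduct⁺ (∈-allFin _) (∈-allFin _)) x≢y

∈-arcs⁻ : ∀ {n} {x y : Fin n} → (x , y) ∈ arcs n → x ≢ y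
∈-arcs⁻ {n} = proj₂ ∘ ∈-filter⁻ (λ p → ¬? (proj₁ p Fin.≟ proj₂ p)) {xs = cartesianProduct (allFin n) (allFin n)}

∈-colors⁺ : ∀ {n} (C : ArcColoring n) {x y} → x ≢ y → C x y ∈ colors C
∈-colors⁺ C x≢y = ∈-map⁺ (λ p → C (proj₁ p) (proj₂ p)) (∈-arcs⁺ x≢y)

∈-colors⁻ : ∀ {n} (C : ArcColoring n) {γ} → γ ∈ colors C → ∃[ x ] ∃[ y ] (x ≢ y × C x y ≡ γ)
∈-colors⁻ C γ∈ with (x , y) , xy∈ , refl ← ∈-map⁻ (λ p → C (proj₁ p) (proj₂ p)) γ∈ =
  x , y , ∈-arcs⁻ xy∈ , refl

relabel : ∀ {m n} → (Fin m → Fin n) → ArcColoring n → ArcColoring m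
relabel f C x y = C (f x) (f y)

relabel-rainbowFree : ∀ {m n} {f : Fin m → Fin n} {C : ArcColoring n} →
                      Injective _≡_ _≡_ f → RainbowFree C → RainbowFree (relabel f C)
relabel-rainbowFree f-inj rf (x , y , z , x≢y , y≢z , x≢z , rainbow) =
  rf (_ , _ , _ , x≢y ∘ f-inj , y≢z ∘ f-inj , x≢z ∘ f-inj , rainbow)

module _ {m n} (π : Permutation m n) where

  permute-injective : Injective _≡_ _≡_ (π ⟨$⟩ʳ_)
  permute-injective eq = trans (sym (inverseˡ π)) (trans (cong (π ⟨$⟩ˡ_) eq) (inverseˡ π))

  colors⊆colors-permute : (C : ArcColoring n) → colors C ⊆ colors (relabel (π ⟨$⟩ʳ_) C)
  colors⊆colors-permute C γ∈ with x , y , x≢y , refl ← ∈-colors⁻ C γ∈ =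
    subst₂ (λ x′ y′ → C x′ y′ ∈ colors (relabel (π ⟨$⟩ʳ_) C)) (inverseʳ π) (inverseʳ π)
      (∈-colors⁺ (relabel (π ⟨$⟩ʳ_) C) (x≢y ∘ permute⁻¹-injective))
    where
    permute⁻¹-injective : Injective _≡_ _≡_ (π ⟨$⟩ˡ_)
    permute⁻¹-injective eq = trans (sym (inverseʳ π)) (trans (cong (π ⟨$⟩ʳ_) eq) (inverseʳ π))

removeVertex : ∀ {n} → Fin (suc n) → ArcColoring (suc n) → ArcColoring n
removeVertex v = relabel (punchIn v)

module _ {n} (C : ArcColoring (suc n)) (v : Fin (suc n)) where

  Private : ℕ → Set
  Private γ = γ ∉ colors (removeVertex v C)

  privateColors : List ℕ
  privateColors = filter (_∉? colors (removeVertex v C)) (colors C)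

  privateCount : ℕ
  privateCount = countDistinct privateColors

  colorNumber≤removeVertex+privateCount : colorNumber C ≤ colorNumber (removeVertex v C) + privateCount
  colorNumber≤removeVertex+privateCount =
    ≤-trans (countDistinct-mono split) (countDistinct-++ (colors (removeVertex v C)) privateColors)
    where
    split : colors C ⊆ colors (removeVertex v C) ++ privateColors
    split {γ} γ∈ with γ ∉? colors (removeVertex v C)
    ... | yes γ∉ = ∈-++⁺ʳ _ (∈-filter⁺ (_∉? colors (removeVertex v C)) γ∈ γ∉)
    ... | no γ∈′ = ∈-++⁺ˡ (decidable-stable (_ ∈? _) γ∈′)

  ∈-colors-removeVertex⁺ : ∀ {x y} → x ≢ y → x ≢ v → y ≢ v → C x y ∈ colors (removeVertex v C)
  ∈-colors-removeVertex⁺ x≢y x≢v y≢v =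
    subst₂ (λ x′ y′ → C x′ y′ ∈ colors (removeVertex v C)) (punchIn-punchOut v≢x) (punchIn-punchOut v≢y)
      (∈-colors⁺ (removeVertex v C) (x≢y ∘ λ eq →
        trans (sym (punchIn-punchOut v≢x)) (trans (cong (punchIn v) eq) (punchIn-punchOut v≢y))))
    where
    v≢x = x≢v ∘ sym
    v≢y = y≢v ∘ sym

  Private⇒≢ : ∀ {γ} → Private γ → ∀ {x y} → x ≢ y → x ≢ v → y ≢ v → C x y ≢ γ
  Private⇒≢ γ∉ x≢y x≢v y≢v refl = γ∉ (∈-colors-removeVertex⁺ x≢y x≢v y≢v)

  ∈-privateColors⁻ : ∀ {γ} → γ ∈ privateColors →
    Private γ × (∃[ u ] (u ≢ v × C v u ≡ γ) ⊎ ∃[ u ] (u ≢ v × C u v ≡ γ))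
  ∈-privateColors⁻ {γ} γ∈ = γ∉ , atV (∈-colors⁻ C γ∈C)
    where
    γ∈C = proj₁ (∈-filter⁻ (_∉? colors (removeVertex v C)) {xs = colors C} γ∈)
    γ∉ = proj₂ (∈-filter⁻ (_∉? colors (removeVertex v C)) {xs = colors C} γ∈)
    atV : ∃[ x ] ∃[ y ] (x ≢ y × C x y ≡ γ) → ∃[ u ] (u ≢ v × C v u ≡ γ) ⊎ ∃[ u ] (u ≢ v × C u v ≡ γ)
    atV (x , y , x≢y , refl) with x Fin.≟ v | y Fin.≟ v
    ... | yes refl | _        = inj₁ (y , x≢y ∘ sym , refl)
    ... | no _     | yes refl = inj₂ (x , x≢y , refl)
    ... | no x≢v   | no y≢v   = contradiction (∈-colors-removeVertex⁺ x≢y x≢v y≢v) γ∉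

TwoEqual : ℕ → ℕ → ℕ → Set
TwoEqual a b c = a ≡ b ⊎ b ≡ c ⊎ a ≡ c

module RainbowFreeColoring {n} {C : ArcColoring n} (rf : RainbowFree C) where

  twoColorsEqual : ∀ {x y z} → x ≢ y → y ≢ z → x ≢ z → TwoEqual (C x y) (C y z) (C z x)
  twoColorsEqual {x} {y} {z} x≢y y≢z x≢z with C x y ≟ C y z | C y z ≟ C z x | C x y ≟ C z x
  ... | yes eq | _      | _      = inj₁ eq
  ... | no _   | yes eq | _      = inj₂ (inj₁ eq)
  ... | no _   | no _   | yes eq = inj₂ (inj₂ eq)
  ... | no c₁  | no c₂  | no c₃  = contradiction (x , y , z , x≢y , y≢z , x≢z , c₁ , c₂ , c₃) rf

  twoColors : ∀ {x y z} → x ≢ y → y ≢ z → x ≢ z →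
              ∃[ p ] ∃[ q ] (C x y ∈ p ∷ q ∷ [] × C y z ∈ p ∷ q ∷ [] × C z x ∈ p ∷ q ∷ [])
  twoColors x≢y y≢z x≢z with twoColorsEqual x≢y y≢z x≢z
  ... | inj₁ eq        = _ , _ , here refl , here (sym eq) , there (here refl)
  ... | inj₂ (inj₁ eq) = _ , _ , here refl , there (here refl) , there (here (sym eq))
  ... | inj₂ (inj₂ eq) = _ , _ , here refl , there (here refl) , here (sym eq)

  otherTwoEqual : ∀ {x y z} → x ≢ y → y ≢ z → x ≢ z → C x y ≢ C y z → C x y ≢ C z x → C y z ≡ C z x
  otherTwoEqual x≢y y≢z x≢z c₁ c₃ with twoColorsEqual x≢y y≢z x≢z
  ... | inj₁ eq        = contradiction eq c₁
  ... | inj₂ (inj₁ eq) = eq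
  ... | inj₂ (inj₂ eq) = contradiction eq c₃

module _ {a p} {A : Set a} {P : Pred A p} (P? : Decidable P) where

  length-filter+length-filter-∁ : ∀ xs → length (filter P? xs) + length (filter (¬? ∘ P?) xs) ≡ length xs
  length-filter+length-filter-∁ [] = refl
  length-filter+length-filter-∁ (x ∷ xs) with P? x
  ... | yes _ = cong suc (length-filter+length-filter-∁ xs)
  ... | no _  = trans (+-suc _ _) (cong suc (length-filter+length-filter-∁ xs))

  filter-nonempty⇒∃ : ∀ xs → 0 < length (filter P? xs) → ∃ P
  filter-nonempty⇒∃ (x ∷ xs) 0<len with P? x
  ... | yes px = x , px
  ... | no _   = filter-nonempty⇒∃ xs 0<len

⌈n/2⌉≤1+⌊n/2⌋ : ∀ n → ⌈ n /2⌉ ≤ suc ⌊ n /2⌋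
⌈n/2⌉≤1+⌊n/2⌋ zero = z≤n
⌈n/2⌉≤1+⌊n/2⌋ (suc zero) = s≤s z≤n
⌈n/2⌉≤1+⌊n/2⌋ (suc (suc n)) = s≤s (⌈n/2⌉≤1+⌊n/2⌋ n)

module PrivateColorsOfRainbowFree {n} {C : ArcColoring (suc n)} (rf : RainbowFree C) where

  open RainbowFreeColoring rf

  -- In a triangle v → a → b → v the arc ab avoids v, so it carries no private color of v.
  privateOut≡privateIn : ∀ {v a b} → a ≢ b → a ≢ v → b ≢ v →
                         Private C v (C v a) → Private C v (C b v) → C v a ≡ C b v
  privateOut≡privateIn {v} a≢b a≢v b≢v pa pb =
    sym (otherTwoEqual a≢b b≢v a≢v (Private⇒≢ C v pb a≢b a≢v b≢v) (Private⇒≢ C v pa a≢b a≢v b≢v))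

  privateOut∧privateIn⇒privateCount≤2 : ∀ {v u x} → u ≢ v → Private C v (C v u) →
                                         x ≢ v → Private C v (C x v) → privateCount C v ≤ 2
  privateOut∧privateIn⇒privateCount≤2 {v} {u} {x} u≢v pα x≢v pβ with u Fin.≟ x
  ... | yes refl = ⊆⇒countDistinct≤length sub
    where
    sub : privateColors C v ⊆ C v u ∷ C u v ∷ []
    sub γ∈ with ∈-privateColors⁻ C v γ∈
    ... | pγ , inj₁ (a , a≢v , refl) with a Fin.≟ u
    ...   | yes refl = here refl
    ...   | no a≢u   = there (here (privateOut≡privateIn a≢u a≢v u≢v pγ pβ))
    sub γ∈ | pγ , inj₂ (b , b≢v , refl) with b Fin.≟ u
    ...   | yes refl = there (here refl)
    ...   | no b≢u   = here (sym (privateOut≡privateIn (b≢u ∘ sym) u≢v b≢v pα pγ))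
  ... | no u≢x = bound (C v x ∉? colors (removeVertex v C))
    where
    -- Apart from C v x and C u v, every private color equals C v u = C x v; those two agree if both are private.
    α≡β : C v u ≡ C x v
    α≡β = privateOut≡privateIn u≢x u≢v x≢v pα pβ
    sub : privateColors C v ⊆ C x v ∷ C v x ∷ C u v ∷ []
    sub γ∈ with ∈-privateColors⁻ C v γ∈
    ... | pγ , inj₁ (a , a≢v , refl) with a Fin.≟ x
    ...   | yes refl = there (here refl)
    ...   | no a≢x   = here (privateOut≡privateIn a≢x a≢v x≢v pγ pβ)
    sub γ∈ | pγ , inj₂ (b , b≢v , refl) with b Fin.≟ u
    ...   | yes refl = there (there (here refl))
    ...   | no b≢u   = here (trans (sym (privateOut≡privateIn (b≢u ∘ sym) u≢v b≢v pα pγ)) α≡β)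
    bound : Dec (Private C v (C v x)) → privateCount C v ≤ 2
    bound (yes pvx) = ⊆⇒countDistinct≤length (λ γ∈ → merge (proj₁ (∈-privateColors⁻ C v γ∈)) (sub γ∈))
      where
      merge : ∀ {γ} → Private C v γ → γ ∈ C x v ∷ C v x ∷ C u v ∷ [] → γ ∈ C x v ∷ C v x ∷ []
      merge _  (here eq)                 = here eq
      merge _  (there (here eq))         = there (here eq)
      merge pγ (there (there (here refl))) =
        there (here (sym (privateOut≡privateIn (u≢x ∘ sym) x≢v u≢v pvx pγ)))
    bound (no ¬pvx) = ⊆⇒countDistinct≤length (λ γ∈ → drop (proj₁ (∈-privateColors⁻ C v γ∈)) (sub γ∈))
      where
      drop : ∀ {γ} → Private C v γ → γ ∈ C x v ∷ C v x ∷ C u v ∷ [] → γ ∈ C x v ∷ C u v ∷ []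
      drop _  (here eq)                = here eq
      drop pγ (there (here refl))      = contradiction pγ ¬pvx
      drop _  (there (there (here eq))) = there (here eq)

  HasPrivateOut : Fin (suc n) → Set
  HasPrivateOut v = ∃[ u ] (u ≢ v × Private C v (C v u))

  hasPrivateOut? : ∀ v → Dec (HasPrivateOut v)
  hasPrivateOut? v = any? λ u → ¬? (u Fin.≟ v) ×-dec (C v u ∉? colors (removeVertex v C))

  HasPrivateOut⇒¬privateIn : ∀ {v x} → HasPrivateOut v → 3 ≤ privateCount C v → x ≢ v → ¬ Private C v (C x v)
  HasPrivateOut⇒¬privateIn (u , u≢v , pα) 3≤p x≢v pβ =
    ≤⇒≯ (privateOut∧privateIn⇒privateCount≤2 u≢v pα x≢v pβ) 3≤p

  3≤privateCount⇒¬⊆[_] : ∀ {u} γ → 3 ≤ privateCount C u → ¬ privateColors C u ⊆ γ ∷ []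
  3≤privateCount⇒¬⊆[ γ ] 3≤p sub = ≤⇒≯ (⊆⇒countDistinct≤length sub) (≤-trans (n≤1+n 2) 3≤p)

  privateOut⇒¬HasPrivateOut : ∀ {v u} → 3 ≤ privateCount C v → u ≢ v → Private C v (C v u) →
                              3 ≤ privateCount C u → ¬ HasPrivateOut u
  privateOut⇒¬HasPrivateOut {v} {u} 3≤pv u≢v pα 3≤pu hu = 3≤privateCount⇒¬⊆[ C u v ] 3≤pu sub
    where
    sub : privateColors C u ⊆ C u v ∷ []
    sub γ∈ with ∈-privateColors⁻ C u γ∈
    ... | pγ , inj₂ (x , x≢u , refl) = contradiction pγ (HasPrivateOut⇒¬privateIn hu 3≤pu x≢u)
    ... | pγ , inj₁ (x , x≢u , refl) with x Fin.≟ v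
    ...   | yes refl = here refl
    ...   | no x≢v   = contradiction (sym cux≡cxv) (Private⇒≢ C u pγ x≢v x≢u (u≢v ∘ sym))
      where
      cux≡cxv : C u x ≡ C x v
      cux≡cxv = otherTwoEqual (u≢v ∘ sym) (x≢u ∘ sym) (x≢v ∘ sym)
        (λ eq → Private⇒≢ C v pα (x≢u ∘ sym) u≢v x≢v (sym eq))
        (λ eq → HasPrivateOut⇒¬privateIn (u , u≢v , pα) 3≤pv x≢v (subst (Private C v) eq pα))

  privateIn⇒HasPrivateOut : ∀ {w u} → ¬ HasPrivateOut w → u ≢ w → Private C w (C u w) →
                            3 ≤ privateCount C u → HasPrivateOut u
  privateIn⇒HasPrivateOut {w} {u} ¬hw u≢w pβ 3≤pu with hasPrivateOut? u
  ... | yes hu  = hu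
  ... | no ¬hu = ⊥-elim (3≤privateCount⇒¬⊆[ C w u ] 3≤pu sub)
    where
    sub : privateColors C u ⊆ C w u ∷ []
    sub γ∈ with ∈-privateColors⁻ C u γ∈
    ... | pγ , inj₁ (y , y≢u , refl) = contradiction (y , y≢u , pγ) ¬hu
    ... | pγ , inj₂ (x , x≢u , refl) with x Fin.≟ w
    ...   | yes refl = here refl
    ...   | no x≢w   = contradiction cwx≡cxu (Private⇒≢ C u pγ (x≢w ∘ sym) (u≢w ∘ sym) x≢u)
      where
      cwx≡cxu : C w x ≡ C x u
      cwx≡cxu = otherTwoEqual u≢w (x≢w ∘ sym) (x≢u ∘ sym)
        (λ eq → ¬hw (x , x≢w , subst (Private C w) eq pβ))
        (λ eq → Private⇒≢ C w pβ x≢u x≢w u≢w (sym eq))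

  module _ (3≤p : ∀ u → 3 ≤ privateCount C u) where

    withPrivateOut withoutPrivateOut : List (Fin (suc n))
    withPrivateOut    = filter hasPrivateOut? (allFin (suc n))
    withoutPrivateOut = filter (¬? ∘ hasPrivateOut?) (allFin (suc n))

    HasPrivateOut⇒privateCount≤ : ∀ {v} → HasPrivateOut v → privateCount C v ≤ length withoutPrivateOut
    HasPrivateOut⇒privateCount≤ {v} hv =
      ≤-trans (⊆⇒countDistinct≤length sub) (≤-reflexive (length-map (C v) withoutPrivateOut))
      where
      sub : privateColors C v ⊆ map (C v) withoutPrivateOut
      sub γ∈ with ∈-privateColors⁻ C v γ∈
      ... | pγ , inj₂ (x , x≢v , refl) = contradiction pγ (HasPrivateOut⇒¬privateIn hv (3≤p v) x≢v)
      ... | pγ , inj₁ (u , u≢v , refl) = ∈-map⁺ (C v) (∈-filter⁺ (¬? ∘ hasPrivateOut?) (∈-allFin u)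
                                           (privateOut⇒¬HasPrivateOut (3≤p v) u≢v pγ (3≤p u)))

    ¬HasPrivateOut⇒privateCount≤ : ∀ {w} → ¬ HasPrivateOut w → privateCount C w ≤ length withPrivateOut
    ¬HasPrivateOut⇒privateCount≤ {w} ¬hw =
      ≤-trans (⊆⇒countDistinct≤length sub) (≤-reflexive (length-map (λ u → C u w) withPrivateOut))
      where
      sub : privateColors C w ⊆ map (λ u → C u w) withPrivateOut
      sub γ∈ with ∈-privateColors⁻ C w γ∈
      ... | pγ , inj₁ (y , y≢w , refl) = contradiction (y , y≢w , pγ) ¬hw
      ... | pγ , inj₂ (u , u≢w , refl) = ∈-map⁺ (λ u → C u w) (∈-filter⁺ hasPrivateOut? (∈-allFin u)
                                           (privateIn⇒HasPrivateOut ¬hw u≢w pγ (3≤p u)))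

  -- If every vertex had more than h = ⌊(n+1)/2⌋ private colors, the vertices with and without a
  -- private out-color would both number more than h.
  ∃privateCount≤⌊n/2⌋ : 3 ≤ n → ∃[ v ] privateCount C v ≤ ⌊ suc n /2⌋
  ∃privateCount≤⌊n/2⌋ 3≤n with any? (λ v → privateCount C v ≤? ⌊ suc n /2⌋)
  ... | yes found = found
  ... | no none   = ⊥-elim (≤⇒≯ n+1≤h+h+1 (≤-trans (+-mono-≤ (proj₁ large) (proj₂ large)) total))
    where
    h = ⌊ suc n /2⌋
    h<p : ∀ v → h < privateCount C v
    h<p v = ≰⇒> (none ∘ (v ,_))
    3≤p : ∀ v → 3 ≤ privateCount C v
    3≤p v = ≤-trans (s≤s (⌊n/2⌋-mono (s≤s 3≤n))) (h<p v)
    large : h < length (withPrivateOut 3≤p) × h < length (withoutPrivateOut 3≤p)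
    large with hasPrivateOut? zero
    ... | yes h0 =
      let h<T = ≤-trans (h<p zero) (HasPrivateOut⇒privateCount≤ 3≤p h0)
          (w , ¬hw) = filter-nonempty⇒∃ (¬? ∘ hasPrivateOut?) (allFin (suc n)) (≤-trans (s≤s z≤n) h<T)
      in ≤-trans (h<p w) (¬HasPrivateOut⇒privateCount≤ 3≤p ¬hw) , h<T
    ... | no ¬h0 =
      let h<S = ≤-trans (h<p zero) (¬HasPrivateOut⇒privateCount≤ 3≤p ¬h0)
          (v , hv) = filter-nonempty⇒∃ hasPrivateOut? (allFin (suc n)) (≤-trans (s≤s z≤n) h<S)
      in h<S , ≤-trans (h<p v) (HasPrivateOut⇒privateCount≤ 3≤p hv)
    total : length (withPrivateOut 3≤p) + length (withoutPrivateOut 3≤p) ≤ suc n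
    total = ≤-reflexive (trans (length-filter+length-filter-∁ hasPrivateOut? (allFin (suc n))) (length-tabulate id))
    n+1≤h+h+1 : suc n ≤ h + suc h
    n+1≤h+h+1 = ≤-trans (≤-reflexive (sym (⌊n/2⌋+⌈n/2⌉≡n (suc n)))) (+-monoʳ-≤ h (⌈n/2⌉≤1+⌊n/2⌋ (suc n)))

colorNumber≤4 : {C : ArcColoring 3} → RainbowFree C → colorNumber C ≤ 4
colorNumber≤4 {C} rf with RainbowFreeColoring.twoColors rf {0F} {1F} {2F} (λ ()) (λ ()) (λ ())
                        | RainbowFreeColoring.twoColors rf {0F} {2F} {1F} (λ ()) (λ ()) (λ ())
... | p , q , c₀₁ , c₁₂ , c₂₀ | p′ , q′ , c₀₂ , c₂₁ , c₁₀ = ⊆⇒countDistinct≤length sub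
  where
  sub : colors C ⊆ p ∷ q ∷ p′ ∷ q′ ∷ []
  sub γ∈ with ∈-colors⁻ C γ∈
  ... | 0F , 0F , x≢y , _    = contradiction refl x≢y
  ... | 0F , 1F , _   , refl = ∈-++⁺ˡ c₀₁
  ... | 0F , 2F , _   , refl = ∈-++⁺ʳ (p ∷ q ∷ []) c₀₂
  ... | 1F , 0F , _   , refl = ∈-++⁺ʳ (p ∷ q ∷ []) c₁₀
  ... | 1F , 1F , x≢y , _    = contradiction refl x≢y
  ... | 1F , 2F , _   , refl = ∈-++⁺ˡ c₁₂
  ... | 2F , 0F , _   , refl = ∈-++⁺ˡ c₂₀
  ... | 2F , 1F , _   , refl = ∈-++⁺ʳ (p ∷ q ∷ []) c₂₁
  ... | 2F , 2F , x≢y , _    = contradiction refl x≢y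

colorNumber-step : ∀ {n k} → 3 ≤ n → (∀ (D : ArcColoring n) → RainbowFree D → colorNumber D ≤ k) →
                   (C : ArcColoring (suc n)) → RainbowFree C → colorNumber C ≤ k + ⌊ suc n /2⌋
colorNumber-step 3≤n bound C rf with v , pv≤ ← PrivateColorsOfRainbowFree.∃privateCount≤⌊n/2⌋ rf 3≤n =
  ≤-trans (colorNumber≤removeVertex+privateCount C v)
          (+-mono-≤ (bound _ (relabel-rainbowFree (punchIn-injective v _ _) rf)) pv≤)

colorNumber≤6 : (C : ArcColoring 4) → RainbowFree C → colorNumber C ≤ 6
colorNumber≤6 = colorNumber-step (s≤s (s≤s (s≤s z≤n))) (λ _ → colorNumber≤4)

nth : List ℕ → ℕ → ℕ
nth []       _       = 0
nth (x ∷ _)  zero    = x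
nth (_ ∷ xs) (suc i) = nth xs i

nth-∷ʳ-< : ∀ xs {y t} → t < length xs → nth (xs ∷ʳ y) t ≡ nth xs t
nth-∷ʳ-< (x ∷ xs) {t = zero}  _   = refl
nth-∷ʳ-< (x ∷ xs) {t = suc t} t<n = nth-∷ʳ-< xs (s<s⁻¹ t<n)

nth-∷ʳ-length : ∀ xs {y} → nth (xs ∷ʳ y) (length xs) ≡ y
nth-∷ʳ-length []       = refl
nth-∷ʳ-length (x ∷ xs) = nth-∷ʳ-length xs

nth-∈ : ∀ xs {j} → j < length xs → nth xs j ∈ xs
nth-∈ (x ∷ xs) {zero}  _   = here refl
nth-∈ (x ∷ xs) {suc j} j<n = there (nth-∈ xs (s<s⁻¹ j<n))

∈⇒∃nth : ∀ {x xs} → x ∈ xs → ∃[ j ] (j < length xs × nth xs j ≡ x)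
∈⇒∃nth (here refl) = zero , s≤s z≤n , refl
∈⇒∃nth (there x∈xs) with j , j<n , eq ← ∈⇒∃nth x∈xs = suc j , s≤s j<n , eq

nth-injective : ∀ {xs i j} → Unique xs → i < length xs → j < length xs → nth xs i ≡ nth xs j → i ≡ j
nth-injective {x ∷ xs} {zero}  {zero}  _          _   _   _  = refl
nth-injective {x ∷ xs} {zero}  {suc j} (x∉ ∷ _)  _   j<n eq =
  contradiction eq (All.lookup x∉ (nth-∈ xs (s<s⁻¹ j<n)))
nth-injective {x ∷ xs} {suc i} {zero}  (x∉ ∷ _)  i<n _   eq =
  contradiction (sym eq) (All.lookup x∉ (nth-∈ xs (s<s⁻¹ i<n)))
nth-injective {x ∷ xs} {suc i} {suc j} (_ ∷ xs!) i<n j<n eq =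
  cong suc (nth-injective xs! (s<s⁻¹ i<n) (s<s⁻¹ j<n) eq)

length-∷ʳ : ∀ {A : Set} (xs : List A) {y} → length (xs ∷ʳ y) ≡ suc (length xs)
length-∷ʳ xs = trans (length-++ xs) (+-comm _ 1)

twoEqualᵇ : ℕ → ℕ → ℕ → Bool
twoEqualᵇ a b c = (a ≡ᵇ b) ∨ (b ≡ᵇ c) ∨ (a ≡ᵇ c)

TwoEqual⇒T-twoEqualᵇ : ∀ {a b c} → TwoEqual a b c → T (twoEqualᵇ a b c)
TwoEqual⇒T-twoEqualᵇ {a} {b} {c} two = Equivalence.from (T-∨ {a ≡ᵇ b}) (Sum.map₂ (Equivalence.from (T-∨ {b ≡ᵇ c}))
  (Sum.map (≡⇒≡ᵇ a b) (Sum.map (≡⇒≡ᵇ b c) (≡⇒≡ᵇ a c)) two))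

NotRainbowUpTo : (ℕ → ℕ) → ℕ → ℕ × ℕ × ℕ → Set
NotRainbowUpTo col t (a , b , c) = a ≤ t × b ≤ t × c ≤ t × TwoEqual (col a) (col b) (col c)

T-if-then-true : ∀ {b e} → T (if b then e else true) → T b → T e
T-if-then-true {true} t _ = t

nth-∷ʳ-elim : ∀ (P : ℕ → ℕ → Set) xs {y i} → length xs ≡ i →
              (∀ {t} → t < i → P (nth xs t) t) → P y i → ∀ {t} → t < suc i → P (nth (xs ∷ʳ y) t) t
nth-∷ʳ-elim P xs refl old new {t} t<1+i with m≤n⇒m<n∨m≡n (s≤s⁻¹ t<1+i)
... | inj₁ t<i  = subst (λ x → P x t) (sym (nth-∷ʳ-< xs t<i)) (old t<i)
... | inj₂ refl = subst (λ x → P x t) (sym (nth-∷ʳ-length xs)) new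

-- Exhaustive search over the colorings of arcs 0, 1, …, total − 1, each represented by its pattern:
-- the rank of every arc's color in order of first appearance.  explore f i k p continues a pattern
-- p of i arcs using k colors, with f arcs left.  A branch is closed once a triangle of trianglesAt i
-- (triangles, as arc indices, whose last arc is i) turns rainbow, once totalColors colors are out of
-- reach, or when the first cut arcs carry fewer than cutColors colors.
module ColorPatternSearch (trianglesAt : ℕ → List (ℕ × ℕ × ℕ)) (cut cutColors total totalColors : ℕ) where

  consistent : List ℕ → List (ℕ × ℕ × ℕ) → Bool
  consistent p []                = true
  consistent p ((a , b , c) ∷ ts) = twoEqualᵇ (nth p a) (nth p b) (nth p c) ∧ consistent p ts

  settled : ℕ → ℕ → ℕ → Bool
  settled f i k = (k + f <ᵇ totalColors) ∨ ((i ≡ᵇ cut) ∧ (k <ᵇ cutColors))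

  explore : (f i k : ℕ) → List ℕ → Bool
  expand  : (f i k : ℕ) → List ℕ → Bool
  extendBy : (f i k : ℕ) → List ℕ → ℕ → Bool
  extendByAll : (f i k : ℕ) → List ℕ → List ℕ → Bool

  explore f i k p = settled f i k ∨ expand f i k p

  expand zero    i k p = false
  expand (suc f) i k p = extendByAll f i k p (upTo k) ∧ extendBy f i (suc k) p k

  extendBy f i k p c = if consistent (p ∷ʳ c) (trianglesAt i) then explore f (suc i) k (p ∷ʳ c) else true

  extendByAll f i k p []       = true
  extendByAll f i k p (c ∷ cs) = extendBy f i k p c ∧ extendByAll f i k p cs

  module Soundness (col : ℕ → ℕ) (trianglesAt-ok : ∀ t → t < total → All (NotRainbowUpTo col t) (trianglesAt t))
                   (cut-colorful : cutColors ≤ countDistinct (map col (upTo cut)))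
                   (colorful : totalColors ≤ countDistinct (map col (upTo total))) where

    record Encodes (i k : ℕ) (p : List ℕ) : Set where
      field
        palette        : List ℕ
        palette-unique : Unique palette
        palette-length : length palette ≡ k
        pattern-length : length p ≡ i
        decode         : ∀ {t} → t < i → nth p t < k × nth palette (nth p t) ≡ col t

      nth-palette-∈ : ∀ {j} → j < k → nth palette j ∈ palette
      nth-palette-∈ j<k = nth-∈ palette (subst (_ <_) (sym palette-length) j<k)

      first⊆palette : map col (upTo i) ⊆ palette
      first⊆palette γ∈ with t , t∈ , refl ← ∈-map⁻ col γ∈ =
        subst (_∈ palette) (proj₂ (decode (∈-upTo⁻ t∈))) (nth-palette-∈ (proj₁ (decode (∈-upTo⁻ t∈))))

      all⊆palette++rest : ∀ f → i + f ≡ total → map col (upTo total) ⊆ palette ++ map col (applyUpTo (i +_) f)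
      all⊆palette++rest f refl γ∈ with t , t∈ , refl ← ∈-map⁻ col γ∈ with t <? i
      ... | yes t<i = ∈-++⁺ˡ (first⊆palette (∈-map⁺ col (∈-upTo⁺ t<i)))
      ... | no t≮i  = ∈-++⁺ʳ palette (subst (_∈ map col (applyUpTo (i +_) f)) (cong col (m+[n∸m]≡n (≮⇒≥ t≮i)))
                         (∈-map⁺ col (∈-applyUpTo⁺ (i +_) t∸i<f)))
        where
        t∸i<f : t ∸ i < f
        t∸i<f = <-≤-trans (∸-monoˡ-< (∈-upTo⁻ t∈) (≮⇒≥ t≮i)) (≤-reflexive (m+n∸m≡n i f))
    open Encodes

    extend-old : ∀ {i k p} (e : Encodes i k p) {j} → j < k → nth (palette e) j ≡ col i → Encodes (suc i) k (p ∷ʳ j)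
    extend-old {i} {k} {p} e j<k eq = record
      { palette        = palette e
      ; palette-unique = palette-unique e
      ; palette-length = palette-length e
      ; pattern-length = trans (length-∷ʳ p) (cong suc (pattern-length e))
      ; decode         = nth-∷ʳ-elim (λ x t → x < k × nth (palette e) x ≡ col t) p (pattern-length e) (decode e) (j<k , eq)
      }

    extend-new : ∀ {i k p} (e : Encodes i k p) → col i ∉ palette e → Encodes (suc i) (suc k) (p ∷ʳ k)
    extend-new {i} {k} {p} e γ∉ = record
      { palette        = palette e ∷ʳ col i
      ; palette-unique = Unique.++⁺ (palette-unique e) ([] ∷ []) λ { (γ∈ , here refl) → γ∉ γ∈ }
      ; palette-length = trans (length-∷ʳ (palette e)) (cong suc (palette-length e))
      ; pattern-length = trans (length-∷ʳ p) (cong suc (pattern-length e))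
      ; decode         = nth-∷ʳ-elim (λ x t → x < suc k × nth (palette e ∷ʳ col i) x ≡ col t) p (pattern-length e)
                           (λ t<i → let x<k , eq = decode e t<i in
                              m<n⇒m<1+n x<k , trans (nth-∷ʳ-< (palette e) (subst (_ <_) (sym (palette-length e)) x<k)) eq)
                           (n<1+n k , subst (λ m → nth (palette e ∷ʳ col i) m ≡ col i) (palette-length e)
                                                (nth-∷ʳ-length (palette e)))
      }

    extend : ∀ {i k p} → Encodes i k p →
             (∃[ j ] (j < k × Encodes (suc i) k (p ∷ʳ j))) ⊎ Encodes (suc i) (suc k) (p ∷ʳ k)
    extend {i} e with col i ∈? palette e
    ... | no γ∉  = inj₂ (extend-new e γ∉)
    ... | yes γ∈ with j , j<len , eq ← ∈⇒∃nth γ∈ =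
      let j<k = subst (_ <_) (palette-length e) j<len in inj₁ (j , j<k , extend-old e j<k eq)

    Encodes⇒consistent : ∀ {i k p} → Encodes (suc i) k p → i < total → T (consistent p (trianglesAt i))
    Encodes⇒consistent {i} {k} {p} e i<total = go (trianglesAt-ok i i<total)
      where
      nth-p-cong : ∀ {a b} → a ≤ i → b ≤ i → col a ≡ col b → nth p a ≡ nth p b
      nth-p-cong a≤i b≤i eq with a<k , eqa ← decode e (s≤s a≤i) | b<k , eqb ← decode e (s≤s b≤i) =
        nth-injective (palette-unique e) (subst (_ <_) (sym (palette-length e)) a<k)
          (subst (_ <_) (sym (palette-length e)) b<k) (trans eqa (trans eq (sym eqb)))
      go : ∀ {ts} → All (NotRainbowUpTo col i) ts → T (consistent p ts)
      go [] = _
      go ((a≤i , b≤i , c≤i , two) ∷ rest) = Equivalence.from T-∧ (TwoEqual⇒T-twoEqualᵇ (same two) , go rest)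
        where
        same : TwoEqual (col _) (col _) (col _) → TwoEqual (nth p _) (nth p _) (nth p _)
        same (inj₁ eq)        = inj₁ (nth-p-cong a≤i b≤i eq)
        same (inj₂ (inj₁ eq)) = inj₂ (inj₁ (nth-p-cong b≤i c≤i eq))
        same (inj₂ (inj₂ eq)) = inj₂ (inj₂ (nth-p-cong a≤i c≤i eq))

    ¬settled : ∀ {i k p} f → Encodes i k p → i + f ≡ total → ¬ T (settled f i k)
    ¬settled {i} {k} f e i+f≡total s with Equivalence.to T-∨ s
    ... | inj₁ few = ≤⇒≯ (≤-trans colorful (≤-trans (⊆⇒countDistinct≤length (all⊆palette++rest e f i+f≡total))
                           (≤-reflexive length-eq))) (<ᵇ⇒< _ _ few)
      where
      length-eq : length (palette e ++ map col (applyUpTo (i +_) f)) ≡ k + f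
      length-eq = trans (length-++ (palette e))
                    (cong₂ _+_ (palette-length e) (trans (length-map col (applyUpTo (i +_) f)) (length-applyUpTo (i +_) f)))
    ... | inj₂ cut-few with i≡cut , few ← Equivalence.to T-∧ cut-few with refl ← ≡ᵇ⇒≡ i cut i≡cut =
      ≤⇒≯ (≤-trans cut-colorful
            (≤-trans (⊆⇒countDistinct≤length (first⊆palette e)) (≤-reflexive (palette-length e))))
          (<ᵇ⇒< _ _ few)

    T-extendByAll⁻ : ∀ {f i k p c cs} → T (extendByAll f i k p cs) → c ∈ cs → T (extendBy f i k p c)
    T-extendByAll⁻ {cs = _ ∷ _} t (here refl) = proj₁ (Equivalence.to T-∧ t)
    T-extendByAll⁻ {cs = _ ∷ _} t (there c∈)  = T-extendByAll⁻ (proj₂ (Equivalence.to T-∧ t)) c∈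

    sound : ∀ f {i k p} → T (explore f i k p) → i + f ≡ total → Encodes i k p → ⊥
    sound f {i} e i+f≡total enc with Equivalence.to T-∨ e
    ... | inj₁ s = ¬settled f enc i+f≡total s
    sound (suc f) {i} {k} {p} e i+f≡total enc | inj₂ x = continue (Equivalence.to T-∧ x) (extend enc)
      where
      i<total : i < total
      i<total = subst (i <_) i+f≡total (m<m+n i (s≤s z≤n))
      next : ∀ {k′ c} → T (extendBy f i k′ p c) → Encodes (suc i) k′ (p ∷ʳ c) → ⊥
      next t enc′ = sound f (T-if-then-true t (Encodes⇒consistent enc′ i<total)) (trans (sym (+-suc i f)) i+f≡total) enc′
      continue : T (extendByAll f i k p (upTo k)) × T (extendBy f i (suc k) p k) →
                 (∃[ j ] (j < k × Encodes (suc i) k (p ∷ʳ j))) ⊎ Encodes (suc i) (suc k) (p ∷ʳ k) → ⊥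
      continue (old-ok , _) (inj₁ (j , j<k , enc′)) = next (T-extendByAll⁻ old-ok (∈-upTo⁺ j<k)) enc′
      continue (_ , new-ok) (inj₂ enc′)             = next new-ok enc′

  search-sound : explore total 0 0 [] ≡ true → (col : ℕ → ℕ) →
                 (∀ t → t < total → All (NotRainbowUpTo col t) (trianglesAt t)) →
                 cutColors ≤ countDistinct (map col (upTo cut)) → countDistinct (map col (upTo total)) < totalColors
  search-sound done col ok cut-colorful = ≰⇒> λ colorful →
    Soundness.sound col ok cut-colorful colorful total (Equivalence.from T-≡ done) refl record
      { palette = [] ; palette-unique = [] ; palette-length = refl ; pattern-length = refl ; decode = λ () }

-- The 12 arcs avoiding vertex 4 come first.
arcK5 : ℕ → Fin 5 × Fin 5
arcK5 0  = 0F , 1F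
arcK5 1  = 1F , 0F
arcK5 2  = 0F , 2F
arcK5 3  = 1F , 2F
arcK5 4  = 2F , 0F
arcK5 5  = 2F , 1F
arcK5 6  = 0F , 3F
arcK5 7  = 1F , 3F
arcK5 8  = 2F , 3F
arcK5 9  = 3F , 0F
arcK5 10 = 3F , 1F
arcK5 11 = 3F , 2F
arcK5 12 = 0F , 4F
arcK5 13 = 1F , 4F
arcK5 14 = 2F , 4F
arcK5 15 = 3F , 4F
arcK5 16 = 4F , 0F
arcK5 17 = 4F , 1F
arcK5 18 = 4F , 2F
arcK5 19 = 4F , 3F
arcK5 _  = 0F , 1F

-- Soundness of the search only needs these triangles to be genuine, not all triangles to be listed.
trianglesAtK5 : ℕ → List (ℕ × ℕ × ℕ)
trianglesAtK5 4  = (0 , 3 , 4) ∷ []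
trianglesAtK5 5  = (2 , 5 , 1) ∷ []
trianglesAtK5 9  = (0 , 7 , 9) ∷ (2 , 8 , 9) ∷ []
trianglesAtK5 10 = (6 , 10 , 1) ∷ (3 , 8 , 10) ∷ []
trianglesAtK5 11 = (6 , 11 , 4) ∷ (7 , 11 , 5) ∷ []
trianglesAtK5 16 = (0 , 13 , 16) ∷ (2 , 14 , 16) ∷ (6 , 15 , 16) ∷ []
trianglesAtK5 17 = (12 , 17 , 1) ∷ (3 , 14 , 17) ∷ (7 , 15 , 17) ∷ []
trianglesAtK5 18 = (12 , 18 , 4) ∷ (13 , 18 , 5) ∷ (8 , 15 , 18) ∷ []
trianglesAtK5 19 = (12 , 19 , 9) ∷ (13 , 19 , 10) ∷ (14 , 19 , 11) ∷ []
trianglesAtK5 _  = []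

_≟ᵃ_ : DecidableEquality (Fin 5 × Fin 5)
_≟ᵃ_ = ≡-dec Fin._≟_ Fin._≟_

IsTriangleUpTo : ℕ → ℕ × ℕ × ℕ → Set
IsTriangleUpTo t (a , b , c) = a ≤ t × b ≤ t × c ≤ t ×
  ∃[ x ] ∃[ y ] ∃[ z ] (x ≢ y × y ≢ z × x ≢ z × arcK5 a ≡ (x , y) × arcK5 b ≡ (y , z) × arcK5 c ≡ (z , x))

trianglesAtK5-valid : ∀ {t} → t < 20 → All (IsTriangleUpTo t) (trianglesAtK5 t)
trianglesAtK5-valid = toWitness {a? = allUpTo? (λ t → All.all? (isTriangleUpTo? t) (trianglesAtK5 t)) 20} _
  where
  isTriangleUpTo? : ∀ t tri → Dec (IsTriangleUpTo t tri)
  isTriangleUpTo? t (a , b , c) = a ≤? t ×-dec b ≤? t ×-dec c ≤? t ×-dec any? λ x → any? λ y → any? λ z →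
    ¬? (x Fin.≟ y) ×-dec ¬? (y Fin.≟ z) ×-dec ¬? (x Fin.≟ z) ×-dec
    (arcK5 a ≟ᵃ (x , y)) ×-dec (arcK5 b ≟ᵃ (y , z)) ×-dec (arcK5 c ≟ᵃ (z , x))

arcK5-complete : ∀ (x y : Fin 5) → x ≢ y → ∃[ t ] (t < 20 × arcK5 t ≡ (x , y))
arcK5-complete = toWitness {a? = all? λ x → all? λ y → ¬? (x Fin.≟ y) →-dec anyUpTo? (λ t → arcK5 t ≟ᵃ (x , y)) 20} _

arcK5-complete-K4 : ∀ (x y : Fin 4) → x ≢ y → ∃[ t ] (t < 12 × arcK5 t ≡ (punchIn 4F x , punchIn 4F y))
arcK5-complete-K4 = toWitness {a? = all? λ x → all? λ y → ¬? (x Fin.≟ y) →-dec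
  anyUpTo? (λ t → arcK5 t ≟ᵃ (punchIn 4F x , punchIn 4F y)) 12} _

-- Stated through the unapplied module: through a module application Agda re-runs the search when
-- comparing types.
search-K5 : ColorPatternSearch.explore trianglesAtK5 12 6 20 8 20 0 0 [] ≡ true
search-K5 = refl

module _ {K : ArcColoring 5} (rf : RainbowFree K) where

  open RainbowFreeColoring rf

  colorOf : ℕ → ℕ
  colorOf t = K (proj₁ (arcK5 t)) (proj₂ (arcK5 t))

  colors-relabel⊆ : ∀ {j} (f : Fin j → Fin 5) {m} → (∀ x y → x ≢ y → ∃[ t ] (t < m × arcK5 t ≡ (f x , f y))) →
                    colors (relabel f K) ⊆ map colorOf (upTo m)
  colors-relabel⊆ f cover γ∈ with x , y , x≢y , refl ← ∈-colors⁻ (relabel f K) γ∈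
                             with t , t<m , eq ← cover x y x≢y =
    subst (_∈ map colorOf (upTo _)) (cong (λ p → K (proj₁ p) (proj₂ p)) eq) (∈-map⁺ colorOf (∈-upTo⁺ t<m))

  trianglesAtK5-notRainbow : ∀ {t} → t < 20 → All (NotRainbowUpTo colorOf t) (trianglesAtK5 t)
  trianglesAtK5-notRainbow = All.map notRainbow ∘ trianglesAtK5-valid
    where
    notRainbow : ∀ {t tri} → IsTriangleUpTo t tri → NotRainbowUpTo colorOf t tri
    notRainbow (a≤t , b≤t , c≤t , x , y , z , x≢y , y≢z , x≢z , ea , eb , ec) rewrite ea | eb | ec =
      a≤t , b≤t , c≤t , twoColorsEqual x≢y y≢z x≢z

  colorful-K4⇒colorNumber≤7 : 6 ≤ colorNumber (removeVertex 4F K) → colorNumber K ≤ 7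
  colorful-K4⇒colorNumber≤7 6≤ = ≤-pred (≤-trans (s≤s (countDistinct-mono (colors-relabel⊆ id arcK5-complete)))
    (ColorPatternSearch.search-sound trianglesAtK5 12 6 20 8 search-K5 colorOf (λ _ → trianglesAtK5-notRainbow)
      (≤-trans 6≤ (countDistinct-mono (colors-relabel⊆ (punchIn 4F) arcK5-complete-K4)))))

-- Some vertex v has at most two private colors, which settles the case that C − v has at most five
-- colors; otherwise v is moved to vertex 4 and the search applies.
colorNumber≤7 : (C : ArcColoring 5) → RainbowFree C → colorNumber C ≤ 7
colorNumber≤7 C rf with v , pv≤2 ← PrivateColorsOfRainbowFree.∃privateCount≤⌊n/2⌋ rf (s≤s (s≤s (s≤s z≤n)))
                      | colorNumber (removeVertex v C) ≤? 5
... | yes ≤5 = ≤-trans (colorNumber≤removeVertex+privateCount C v) (+-mono-≤ ≤5 pv≤2)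
... | no ≰5  = ≤-trans (countDistinct-mono (colors⊆colors-permute π C))
                 (colorful-K4⇒colorNumber≤7 (relabel-rainbowFree (permute-injective π) rf)
                   (subst (6 ≤_) (sym K-4≡C-v) (≰⇒> ≰5)))
  where
  π : Permutation 5 5
  π = insert 4F v Permutation.id
  K-4≡C-v : colorNumber (removeVertex 4F (relabel (π ⟨$⟩ʳ_) C)) ≡ colorNumber (removeVertex v C)
  K-4≡C-v = cong (length ∘ deduplicate _≟_) (map-cong (λ (x , y) →
    cong₂ C (insert-punchIn 4F v Permutation.id x) (insert-punchIn 4F v Permutation.id y)) (arcs 4))

⌊n²/4⌋≡⌊n/2⌋*⌈n/2⌉ : ∀ n → n * n / 4 ≡ ⌊ n /2⌋ * ⌈ n /2⌉
⌊n²/4⌋≡⌊n/2⌋*⌈n/2⌉ zero = refl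
⌊n²/4⌋≡⌊n/2⌋*⌈n/2⌉ (suc zero) = refl
⌊n²/4⌋≡⌊n/2⌋*⌈n/2⌉ (suc (suc n)) = begin
  (2 + n) * (2 + n) / 4                      ≡⟨ cong (_/ 4) (square n) ⟩
  (n * n + (1 + n) * 4) / 4                  ≡⟨ +-distrib-/-∣ʳ (n * n) (divides-refl (1 + n)) ⟩
  n * n / 4 + (1 + n) * 4 / 4                ≡⟨ cong₂ _+_ (⌊n²/4⌋≡⌊n/2⌋*⌈n/2⌉ n) (m*n/n≡m (1 + n) 4) ⟩
  ⌊ n /2⌋ * ⌈ n /2⌉ + (1 + n)                ≡⟨ cong (λ m → ⌊ n /2⌋ * ⌈ n /2⌉ + (1 + m)) (sym (⌊n/2⌋+⌈n/2⌉≡n n)) ⟩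
  ⌊ n /2⌋ * ⌈ n /2⌉ + (1 + (⌊ n /2⌋ + ⌈ n /2⌉)) ≡⟨ product ⌊ n /2⌋ ⌈ n /2⌉ ⟩
  (1 + ⌊ n /2⌋) * (1 + ⌈ n /2⌉)              ∎
  where
  open ≡-Reasoning
  square : ∀ n → (2 + n) * (2 + n) ≡ n * n + (1 + n) * 4
  square = solve-∀
  product : ∀ a b → a * b + (1 + (a + b)) ≡ (1 + a) * (1 + b)
  product = solve-∀

⌊[n+1]²/4⌋≡⌊n²/4⌋+⌈n/2⌉ : ∀ n → suc n * suc n / 4 ≡ n * n / 4 + ⌈ n /2⌉
⌊[n+1]²/4⌋≡⌊n²/4⌋+⌈n/2⌉ n = begin
  suc n * suc n / 4             ≡⟨ ⌊n²/4⌋≡⌊n/2⌋*⌈n/2⌉ (suc n) ⟩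
  ⌈ n /2⌉ * (1 + ⌊ n /2⌋)       ≡⟨ product ⌊ n /2⌋ ⌈ n /2⌉ ⟩
  ⌊ n /2⌋ * ⌈ n /2⌉ + ⌈ n /2⌉   ≡⟨ cong (_+ ⌈ n /2⌉) (sym (⌊n²/4⌋≡⌊n/2⌋*⌈n/2⌉ n)) ⟩
  n * n / 4 + ⌈ n /2⌉           ∎
  where
  open ≡-Reasoning
  product : ∀ a b → b * (1 + a) ≡ a * b + b
  product = solve-∀

colorNumber≤⌊n²/4⌋+1 : ∀ m (C : ArcColoring (5 + m)) → RainbowFree C → colorNumber C ≤ (5 + m) * (5 + m) / 4 + 1
colorNumber≤⌊n²/4⌋+1 zero    = colorNumber≤7
colorNumber≤⌊n²/4⌋+1 (suc m) C rf =
  ≤-trans (colorNumber-step (s≤s (s≤s (s≤s z≤n))) (colorNumber≤⌊n²/4⌋+1 m) C rf) (≤-reflexive bound-step)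
  where
  n = 5 + m
  bound-step : n * n / 4 + 1 + ⌈ n /2⌉ ≡ suc n * suc n / 4 + 1
  bound-step = begin
    n * n / 4 + 1 + ⌈ n /2⌉   ≡⟨ +-assoc (n * n / 4) 1 ⌈ n /2⌉ ⟩
    n * n / 4 + (1 + ⌈ n /2⌉) ≡⟨ cong (n * n / 4 +_) (+-comm 1 ⌈ n /2⌉) ⟩
    n * n / 4 + (⌈ n /2⌉ + 1) ≡⟨ sym (+-assoc (n * n / 4) ⌈ n /2⌉ 1) ⟩
    n * n / 4 + ⌈ n /2⌉ + 1   ≡⟨ cong (_+ 1) (sym (⌊[n+1]²/4⌋≡⌊n²/4⌋+⌈n/2⌉ n)) ⟩
    suc n * suc n / 4 + 1     ∎
    where open ≡-Reasoning

colorNumber<fValue : ∀ n → 3 ≤ n → (C : ArcColoring n) → RainbowFree C → colorNumber C < fValue n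
colorNumber<fValue 1 (s≤s ())
colorNumber<fValue 2 (s≤s (s≤s ()))
colorNumber<fValue 3 _ C rf = s≤s (colorNumber≤4 rf)
colorNumber<fValue 4 _ C rf = s≤s (colorNumber≤6 C rf)
colorNumber<fValue (suc (suc (suc (suc (suc m))))) _ C rf =
  subst (colorNumber C <_) (sym (+-suc _ 1)) (s≤s (colorNumber≤⌊n²/4⌋+1 m C rf))

bipartite : ∀ a b → ArcColoring (a + b)
bipartite a b x y with splitAt a x | splitAt a y
... | inj₁ i | inj₂ j = suc (toℕ (combine i j))
... | _      | _      = 0

module _ {a b : ℕ} where

  bipartite-≢0 : ∀ {x y} → bipartite a b x y ≢ 0 →
                 (∃[ i ] splitAt a x ≡ inj₁ i) × (∃[ j ] splitAt a y ≡ inj₂ j)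
  bipartite-≢0 {x} {y} ≢0 with splitAt a x | splitAt a y
  ... | inj₁ i | inj₂ j = (i , refl) , (j , refl)
  ... | inj₁ _ | inj₁ _ = contradiction refl ≢0
  ... | inj₂ _ | _      = contradiction refl ≢0

  bipartite-fromRight : ∀ {x y j} → splitAt a x ≡ inj₂ j → bipartite a b x y ≡ 0
  bipartite-fromRight {x} {y} eq with splitAt a x | splitAt a y
  ... | inj₂ _ | _ = refl
  bipartite-fromRight () | inj₁ _ | _

  bipartite-toLeft : ∀ {x y i} → splitAt a y ≡ inj₁ i → bipartite a b x y ≡ 0
  bipartite-toLeft {x} {y} eq with splitAt a x | splitAt a y
  ... | inj₂ _ | _      = refl
  ... | inj₁ _ | inj₁ _ = refl
  bipartite-toLeft () | inj₁ _ | inj₂ _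

  bipartite-rainbowFree : RainbowFree (bipartite a b)
  bipartite-rainbowFree (x , y , z , _ , _ , _ , c₁ , c₂ , c₃) with bipartite a b x y ≟ 0
  ... | no xy≢0 = let (_ , x-left) , (_ , y-right) = bipartite-≢0 xy≢0 in
                  c₂ (trans (bipartite-fromRight y-right) (sym (bipartite-toLeft x-left)))
  ... | yes xy≡0 with bipartite a b y z ≟ 0
  ...   | yes yz≡0 = c₁ (trans xy≡0 (sym yz≡0))
  ...   | no yz≢0  = c₃ (trans xy≡0 (sym (bipartite-fromRight (proj₂ (proj₂ (bipartite-≢0 yz≢0))))))

  bipartite-colorNumber : Fin a → Fin b → suc (a * b) ≤ colorNumber (bipartite a b)
  bipartite-colorNumber i₀ j₀ =
    subst (_≤ colorNumber (bipartite a b)) (length-applyUpTo id (suc (a * b)))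
      (Unique-⊆⇒length≤countDistinct (upTo⁺ (suc (a * b))) sub)
    where
    left≢right : ∀ (i : Fin a) (j : Fin b) → i ↑ˡ b ≢ a ↑ʳ j
    left≢right i j eq with () ← trans (sym (splitAt-↑ˡ a i b)) (trans (cong (splitAt a) eq) (splitAt-↑ʳ a b j))
    sub : upTo (suc (a * b)) ⊆ colors (bipartite a b)
    sub {zero} _ = subst (_∈ colors (bipartite a b)) (bipartite-fromRight (splitAt-↑ʳ a b j₀))
                     (∈-colors⁺ (bipartite a b) (left≢right i₀ j₀ ∘ sym))
    sub {suc k} k∈ with i , j , eq ← combine-surjective (fromℕ< (≤-pred (∈-upTo⁻ k∈))) =
      subst (_∈ colors (bipartite a b)) color-eq (∈-colors⁺ (bipartite a b) (left≢right i j))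
      where
      color-eq : bipartite a b (i ↑ˡ b) (a ↑ʳ j) ≡ suc k
      color-eq rewrite splitAt-↑ˡ a i b | splitAt-↑ʳ a b j = cong suc (trans (cong toℕ eq) (toℕ-fromℕ< _))

extremal3 : ArcColoring 3
extremal3 0F 1F = 0
extremal3 1F 2F = 0
extremal3 2F 0F = 1
extremal3 0F 2F = 2
extremal3 2F 1F = 2
extremal3 1F 0F = 3
extremal3 _  _  = 0

extremal4 : ArcColoring 4
extremal4 0F 1F = 0
extremal4 0F 2F = 1
extremal4 0F 3F = 2
extremal4 1F 0F = 3
extremal4 1F 2F = 2
extremal4 1F 3F = 1
extremal4 2F 0F = 2
extremal4 2F 1F = 1
extremal4 2F 3F = 4
extremal4 3F 0F = 1
extremal4 3F 1F = 2
extremal4 3F 2F = 5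
extremal4 _  _  = 0

extremalColoring : ∀ n → 3 ≤ n → ∃[ C ] (RainbowFree C × fValue n ≤ suc (colorNumber {n} C))
extremalColoring 1 (s≤s ())
extremalColoring 2 (s≤s (s≤s ()))
extremalColoring 3 _ = extremal3 , toWitnessFalse {a? = hasRainbowTriangle? extremal3} _ , ≤-refl
extremalColoring 4 _ = extremal4 , toWitnessFalse {a? = hasRainbowTriangle? extremal4} _ , ≤-refl
extremalColoring n@(suc (suc (suc (suc (suc m))))) _ =
  subst (λ k → ∃[ C ] (RainbowFree C × fValue n ≤ suc (colorNumber {k} C))) (⌊n/2⌋+⌈n/2⌉≡n n)
    (bipartite ⌊ n /2⌋ ⌈ n /2⌉ , bipartite-rainbowFree , bound)
  where
  bound : fValue n ≤ suc (colorNumber (bipartite ⌊ n /2⌋ ⌈ n /2⌉))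
  bound = subst (_≤ suc (colorNumber (bipartite ⌊ n /2⌋ ⌈ n /2⌉)))
            (trans (cong (2 +_) (sym (⌊n²/4⌋≡⌊n/2⌋*⌈n/2⌉ n))) (+-comm 2 (n * n / 4)))
            (s≤s (bipartite-colorNumber {⌊ n /2⌋} {⌈ n /2⌉} zero zero))

forces-if-bounded : ∀ {n k} → (∀ (C : ArcColoring n) → RainbowFree C → colorNumber C < k) → Forces n k
forces-if-bounded bound C k≤c with hasRainbowTriangle? C
... | yes rainbow = rainbow
... | no rf       = contradiction k≤c (<⇒≱ (bound C rf))

Forces⇒colorNumber< : ∀ {n k} → Forces n k → (C : ArcColoring n) → RainbowFree C → colorNumber C < k
Forces⇒colorNumber< forces C rf = ≰⇒> (rf ∘ forces C)

theorem1 : (n : ℕ) → 3 ≤ n → IsLeast (Forces n) (fValue n)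
theorem1 n 3≤n = forces-if-bounded (colorNumber<fValue n 3≤n) , least
  where
  least : ∀ k → Forces n k → fValue n ≤ k
  least k forces with C , rf , fValue≤ ← extremalColoring n 3≤n = ≤-trans fValue≤ (Forces⇒colorNumber< forces C rf)
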